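{- For every agent $i$ and every formula $\phi$ of $\mathbf{LUT}$, $\vDash\bullet_i\phi\to U_i\bullet_i\phi$, and consequently $\vDash\bullet_i\phi\leftrightarrow U_i\bullet_i\phi$.
   Context: Let $\mathbf{P}$ be a countably infinite set of propositional variables and $\mathbf{I}$ a finite set of agents. The language $\mathbf{LUT}$ is given by $\phi::= p\mid\neg\phi\mid(\phi\land\phi)\mid K_i\phi\mid[\phi]\phi\mid U_i\phi$ ($p\in\mathbf{P}$, $i\in\mathbf{I}$); $\mathbf{EL}$ is the fragment without $[\cdot]$ and $U_i$. The abbreviation $\bullet_i\phi$ stands for $\phi\land\neg K_i\phi$. A model is $\mathcal{M}=\langle S,\{R_i\}_{i\in\mathbf{I}},V\rangle$ with $S\neq\emptyset$, each $R_i$ a reflexive relation on $S$, $V:\mathbf{P}\to2^S$. Truth: $p$ true at $s$ iff $s\in V(p)$; Boolean clauses as usual; $\mathcal{M},s\vDash K_i\phi$ iff $\phi$ holds at all $t$ with $sR_it$; $\mathcal{M},s\vDash[\psi]\phi$ iff ($\mathcal{M},s\vDash\psi$ implies $\mathcal{M}|_\psi,s\vDash\phi$), with $\mathcal{M}|_\psi$ the restriction of $\mathcal{M}$ to the states where $\psi$ is true; $\mathcal{M},s\vDash U_i\phi$ iff $\mathcal{M},s\vDash\phi$ and for all $\psi\in\mathbf{EL}$, $\mathcal{M},s\vDash[\psi]\neg K_i\phi$. $\vDash\phi$ means $\phi$ is true at every state of every model. -}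

module Defs where

open import Data.Nat using (ℕ)
open import Data.Fin using (Fin)
open import Data.Product using (Σ; _×_; _,_; proj₁)
open import Relation.Nullary using (¬_)

Prop-Var : Set
Prop-Var = ℕ

Agent : ℕ → Set
Agent n = Fin n

data LUT (n : ℕ) : Set where
  var  : Prop-Var → LUT n
  neg  : LUT n → LUT n
  _and_ : LUT n → LUT n → LUT n
  K    : Agent n → LUT n → LUT n
  [_]_ : LUT n → LUT n → LUT n
  U    : Agent n → LUT n → LUT n

data EL (n : ℕ) : Set where
  var  : Prop-Var → EL n
  neg  : EL n → EL n
  _and_ : EL n → EL n → EL n
  K    : Agent n → EL n → EL n

emb : ∀ {n} → EL n → LUT n
emb (var p) = var p
emb (neg φ) = neg (emb φ)
emb (φ and ψ) = emb φ and emb ψ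
emb (K i φ) = K i (emb φ)

_⇒_ : ∀ {n} → LUT n → LUT n → LUT n
φ ⇒ ψ = neg (φ and neg ψ)

_⇔_ : ∀ {n} → LUT n → LUT n → LUT n
φ ⇔ ψ = (φ ⇒ ψ) and (ψ ⇒ φ)

● : ∀ {n} → Agent n → LUT n → LUT n
● i φ = φ and neg (K i φ)

record Model (n : ℕ) : Set₁ where
  field
    S     : Set
    R     : Agent n → S → S → Set
    R-refl : ∀ i s → R i s s
    V     : Prop-Var → S → Set
open Model public

restrict : ∀ {n} (M : Model n) → (S M → Set) → Model n
restrict M P = record
  { S = Σ (S M) P
  ; R = λ i s t → R M i (proj₁ s) (proj₁ t)
  ; R-refl = λ i s → R-refl M i (proj₁ s)
  ; V = λ p s → V M p (proj₁ s)
  }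

⊨EL : ∀ {n} (M : Model n) → S M → EL n → Set
⊨EL M s (var p) = V M p s
⊨EL M s (neg φ) = ¬ ⊨EL M s φ
⊨EL M s (φ and ψ) = ⊨EL M s φ × ⊨EL M s ψ
⊨EL M s (K i φ) = ∀ t → R M i s t → ⊨EL M t φ

-- Truth of LUT formulas.
-- The U clause is the literal unfolding of:
--   M,s ⊨ φ  and  for all ψ ∈ EL, M,s ⊨ [ψ] ¬ K_i φ,
-- where M,s ⊨ [ψ]χ iff (M,s ⊨ ψ implies M|ψ,s ⊨ χ).
_,_⊨_ : {n : ℕ} (M : Model n) → S M → LUT n → Set
M , s ⊨ var p = V M p s
M , s ⊨ neg φ = ¬ (M , s ⊨ φ)
M , s ⊨ (φ and ψ) = (M , s ⊨ φ) × (M , s ⊨ ψ)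
M , s ⊨ K i φ = ∀ t → R M i s t → M , t ⊨ φ
M , s ⊨ ([ ψ ] φ) = (h : M , s ⊨ ψ) → restrict M (λ t → M , t ⊨ ψ) , (s , h) ⊨ φ
_,_⊨_ {n} M s (U i φ) =
  (M , s ⊨ φ) ×
  ((ψ : EL n) → (h : ⊨EL M s ψ) →
     ¬ (∀ t → R (restrict M (λ u → ⊨EL M u ψ)) i (s , h) t →
          restrict M (λ u → ⊨EL M u ψ) , t ⊨ φ))

Valid : ∀ {n} → LUT n → Set₁
Valid {n} φ = (M : Model n) (s : S M) → M , s ⊨ φ

{-# OPTIONS --safe #-}
-- With reflexive relations, K i (φ ∧ ¬ K i φ) is unsatisfiable: K i distributes to give
-- K i φ, while reflexivity yields ¬ K i φ at the current state. The condition in the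
-- U i clause asks exactly that K i (● i φ) fail in every restricted model, so it holds
-- whenever ● i φ itself does.
module Submission where

open import Defs
open import Data.Nat using (ℕ)
open import Data.Product using (_×_; _,_; proj₁; proj₂)
open import Relation.Nullary using (¬_)

module _ {n : ℕ} where

  valid-⇒ : (φ ψ : LUT n) →
    ((M : Model n) (s : S M) → M , s ⊨ φ → M , s ⊨ ψ) → Valid (φ ⇒ ψ)
  valid-⇒ φ ψ f M s (holds-φ , fails-ψ) = fails-ψ (f M s holds-φ)

  valid-⇔ : (φ ψ : LUT n) →
    ((M : Model n) (s : S M) → M , s ⊨ φ → M , s ⊨ ψ) →
    ((M : Model n) (s : S M) → M , s ⊨ ψ → M , s ⊨ φ) → Valid (φ ⇔ ψ)
  valid-⇔ φ ψ f g M s = valid-⇒ φ ψ f M s , valid-⇒ ψ φ g M s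

  U-factive : (M : Model n) (s : S M) (i : Agent n) (φ : LUT n) →
    M , s ⊨ U i φ → M , s ⊨ φ
  U-factive M s i φ = proj₁

  ¬K● : (M : Model n) (s : S M) (i : Agent n) (φ : LUT n) →
    ¬ (M , s ⊨ K i (● i φ))
  ¬K● M s i φ K●φ = proj₂ (K●φ s (R-refl M i s)) (λ t sRt → proj₁ (K●φ t sRt))

  ●⇒U● : (M : Model n) (s : S M) (i : Agent n) (φ : LUT n) →
    M , s ⊨ ● i φ → M , s ⊨ U i (● i φ)
  ●⇒U● M s i φ ●φ = ●φ , λ ψ s⊨ψ → ¬K● (restrict M (λ u → ⊨EL M u ψ)) (s , s⊨ψ) i φ

mainTheorem11 : (n : ℕ) (i : Agent n) (φ : LUT n) →
    Valid (● i φ ⇒ U i (● i φ)) × Valid (● i φ ⇔ U i (● i φ))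
mainTheorem11 n i φ =
    valid-⇒ (● i φ) (U i (● i φ)) ●φ⇒U●φ
  , valid-⇔ (● i φ) (U i (● i φ)) ●φ⇒U●φ (λ M s → U-factive M s i (● i φ))
  where
  ●φ⇒U●φ : (M : Model n) (s : S M) → M , s ⊨ ● i φ → M , s ⊨ U i (● i φ)
  ●φ⇒U●φ M s = ●⇒U● M s i φ
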